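{- Let $p$ be a prime, $2\le h\le r$ integers, and $\ell_1,\dots,\ell_h$ integers with $p-1\ge\ell_1\ge\ell_2\ge\dots\ge\ell_h\ge1$. Then $$\frac{1+\sum_{i=1}^h\ell_i}{(p-1)\sum_{i=1}^hp^{r-i}(\ell_i+1)}<\frac{1-\frac1p+h(p-1)}{p^{r+1-h}(p^h-1)},$$ except when $\ell_1=\dots=\ell_h=p-1$, in which case $$\frac{1+\sum_{i=1}^h\ell_i}{(p-1)\sum_{i=1}^hp^{r-i}(\ell_i+1)}=\frac{1+h(p-1)}{p^{r+1-h}(p^h-1)}.$$ -}

module Defs where

open import Data.Nat using (ℕ; zero; suc)
open import Data.Integer using (+_)
open import Data.Rational using (ℚ; _/_; _*_; 0ℚ)

-- Division of a rational by a natural number; total, with the (never used)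
-- convention q ÷ℕ 0 = 0.  In the lemma all denominators are positive.
_÷ℕ_ : ℚ → ℕ → ℚ
q ÷ℕ zero    = 0ℚ
q ÷ℕ (suc d) = q * ((+ 1) / suc d)

ℕ→ℚ : ℕ → ℚ
ℕ→ℚ n = (+ n) / 1

module Submission where

-- Write p = q + 1, P = p ^ (r - h), wᵢ = p ^ (r - 1 - i), W = Σ wᵢ, T = Σ wᵢ (ℓᵢ + 1), and let
-- mᵢ = q - ℓᵢ be the deficits.  Clearing denominators, the strict inequality becomes
-- K B + E ≤ C M with M = Σ mᵢ, B = Σ wᵢ mᵢ, K = q (1 + h p), E = p W + 1 and C = p² W.
-- The deficits are nondecreasing and the last one is positive unless every ℓᵢ = q, so by Abel
-- summation m is a nonempty sum of layers 𝟙[i ≥ h - k] with 1 ≤ k ≤ h.  On one layer the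
-- inequality reads E + K P (1 + p + ⋯ + p ^ (k - 1)) ≤ k C; it holds for k = h ≥ 2 and for
-- (k, h) = (1, 2) (tightly when p = 2), and it survives increasing h.  In the equality case
-- q T is exactly the denominator p ^ (r + 1 - h) (p ^ h - 1).

open import Defs
open import Data.Nat using (ℕ; zero; suc; _+_; _*_; _∸_; _^_; _≤_; z≤n; s≤s; _≟_;
  _≤′_; ≤′-refl; ≤′-step; >-nonZero; nonTrivial⇒n>1) renaming (_<_ to _<ℕ_)
open import Data.Nat.Properties
open import Data.Nat.Primality using (Prime; prime⇒nonTrivial)
open import Data.Nat.Tactic.RingSolver using (solve-∀)
open import Algebra.Properties.CommutativeSemigroup +-commutativeSemigroup using (interchange)
open import Data.Fin using (Fin; toℕ; fromℕ)
import Data.Fin as F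
open import Data.Fin.Properties using (toℕ<n; ≤fromℕ)
open import Data.Vec using (sum; tabulate)
open import Data.Vec.Properties using (tabulate-cong)
open import Data.Integer as ℤ using (+_)
import Data.Integer.Properties as ℤ
import Data.Integer.Tactic.RingSolver as ℤ
open import Data.Rational using (toℚᵘ; _<_; _-_; -_) renaming (_+_ to _+ℚ_)
import Data.Rational.Properties as ℚ
open import Data.Rational.Unnormalised as ℚᵘ using (mkℚᵘ; *≡*; *<*; _≃_)
import Data.Rational.Unnormalised.Properties as ℚᵘ
open import Data.Product using (_×_; _,_)
open import Function using (_∘_)
open import Relation.Nullary using (¬_; yes; no; contradiction)
open import Relation.Binary.PropositionalEquality
  using (_≡_; refl; sym; trans; cong; cong₂; subst; subst₂; module ≡-Reasoning)

m+d≡n⇒m≤n : ∀ {m n} d → m + d ≡ n → m ≤ n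
m+d≡n⇒m≤n d refl = m≤m+n _ d

∑ : ∀ {n} → (Fin n → ℕ) → ℕ
∑ f = sum (tabulate f)

∑-cong : ∀ {n} {f g : Fin n → ℕ} → (∀ i → f i ≡ g i) → ∑ f ≡ ∑ g
∑-cong f≗g = cong sum (tabulate-cong f≗g)

∑-distrib-+ : ∀ {n} (f g : Fin n → ℕ) → ∑ (λ i → f i + g i) ≡ ∑ f + ∑ g
∑-distrib-+ {zero}  f g = refl
∑-distrib-+ {suc n} f g = begin
  f F.zero + g F.zero + ∑ (λ i → f (F.suc i) + g (F.suc i))
    ≡⟨ cong (λ s → f F.zero + g F.zero + s) (∑-distrib-+ (f ∘ F.suc) (g ∘ F.suc)) ⟩
  f F.zero + g F.zero + (∑ (f ∘ F.suc) + ∑ (g ∘ F.suc))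
    ≡⟨ interchange (f F.zero) (g F.zero) _ _ ⟩
  ∑ f + ∑ g ∎
  where open ≡-Reasoning

∑-distribˡ : ∀ {n} c (f : Fin n → ℕ) → ∑ (λ i → c * f i) ≡ c * ∑ f
∑-distribˡ {zero}  c f = sym (*-zeroʳ c)
∑-distribˡ {suc n} c f = begin
  c * f F.zero + ∑ (λ i → c * f (F.suc i))
    ≡⟨ cong (λ s → c * f F.zero + s) (∑-distribˡ c (f ∘ F.suc)) ⟩
  c * f F.zero + c * ∑ (f ∘ F.suc)
    ≡⟨ *-distribˡ-+ c (f F.zero) _ ⟨
  c * ∑ f ∎
  where open ≡-Reasoning

∑-distribʳ : ∀ {n} c (f : Fin n → ℕ) → ∑ (λ i → f i * c) ≡ ∑ f * c
∑-distribʳ c f = trans (∑-cong (λ i → *-comm (f i) c)) (trans (∑-distribˡ c f) (*-comm c (∑ f)))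

∑-const : ∀ n c → ∑ {n} (λ _ → c) ≡ n * c
∑-const zero    c = refl
∑-const (suc n) c = cong (λ s → c + s) (∑-const n c)

-- ω (k - 1) + ⋯ + ω 0, indexed so that sumBelow ω (suc k) reduces to ω k + sumBelow ω k.
sumBelow : (ℕ → ℕ) → ℕ → ℕ
sumBelow ω k = ∑ {k} (λ i → ω (k ∸ suc (toℕ i)))

geom : ℕ → ℕ → ℕ
geom p = sumBelow (p ^_)

geom-identity : ∀ q n → q * geom (suc q) n + 1 ≡ suc q ^ n
geom-identity q zero    = cong (_+ 1) (*-zeroʳ q)
geom-identity q (suc n) = begin
  q * (p ^ n + geom p n) + 1     ≡⟨ regroup q (p ^ n) (geom p n) ⟩
  q * p ^ n + (q * geom p n + 1) ≡⟨ cong (λ s → q * p ^ n + s) (geom-identity q n) ⟩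
  q * p ^ n + p ^ n              ≡⟨ +-comm (q * p ^ n) (p ^ n) ⟩
  p ^ suc n                      ∎
  where
  p = suc q
  open ≡-Reasoning
  regroup : ∀ q x y → q * (x + y) + 1 ≡ q * x + (q * y + 1)
  regroup = solve-∀

geom-pos : ∀ q k → 1 ≤ k → 1 ≤ geom (suc q) k
geom-pos q (suc k) _ = ≤-trans (m^n>0 (suc q) k) (m≤m+n _ _)

-- Abel summation: f - f 0 vanishes at 0 and its tail g is an instance of size n, while the
-- constant part f 0 costs exactly the hypothesis at k = n.
abel-bound : ∀ (ω : ℕ → ℕ) (C E n : ℕ) →
  (∀ k → k ≤ n → E + sumBelow ω (suc k) ≤ suc k * C) →
  (f : Fin (suc n) → ℕ) → (∀ {i j} → i F.≤ j → f i ≤ f j) →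
  ∑ (λ i → ω (n ∸ toℕ i) * f i) + f (fromℕ n) * E ≤ C * ∑ f
abel-bound ω C E zero hyp f _ = begin
  ω 0 * f0 + 0 + f0 * E ≡⟨ regroup (ω 0) f0 E ⟩
  f0 * (E + (ω 0 + 0))  ≤⟨ *-monoʳ-≤ f0 (hyp 0 z≤n) ⟩
  f0 * (1 * C)          ≡⟨ regroup′ f0 C ⟩
  C * (f0 + 0)          ∎
  where
  f0 = f F.zero
  open ≤-Reasoning
  regroup : ∀ a f0 E → a * f0 + 0 + f0 * E ≡ f0 * (E + (a + 0))
  regroup = solve-∀
  regroup′ : ∀ f0 C → f0 * (1 * C) ≡ C * (f0 + 0)
  regroup′ = solve-∀
abel-bound ω C E (suc n) hyp f mono = begin
  ω (suc n) * f0 + ∑ (λ i → w i * f (F.suc i)) + f (F.suc (fromℕ n)) * E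
    ≡⟨ cong₂ (λ a b → ω (suc n) * f0 + a + b * E) weighted-split (f-suc (fromℕ n)) ⟩
  ω (suc n) * f0 + (f0 * sumBelow ω (suc n) + ∑ (λ i → w i * g i)) + (f0 + g (fromℕ n)) * E
    ≡⟨ regroup (ω (suc n)) f0 (sumBelow ω (suc n)) _ (g (fromℕ n)) E ⟩
  f0 * (E + sumBelow ω (suc (suc n))) + (∑ (λ i → w i * g i) + g (fromℕ n) * E)
    ≤⟨ +-mono-≤ (*-monoʳ-≤ f0 (hyp (suc n) ≤-refl))
                (abel-bound ω C E n (λ k k≤n → hyp k (m≤n⇒m≤1+n k≤n)) g g-mono) ⟩
  f0 * (suc (suc n) * C) + C * ∑ g
    ≡⟨ regroup′ f0 n C (∑ g) ⟩
  C * (f0 + (suc n * f0 + ∑ g))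
    ≡⟨ cong (λ s → C * (f0 + s)) split ⟨
  C * ∑ f ∎
  where
  open ≤-Reasoning
  f0 = f F.zero
  w g : Fin (suc n) → ℕ
  w i = ω (n ∸ toℕ i)
  g i = f (F.suc i) ∸ f0
  f-suc : ∀ i → f (F.suc i) ≡ f0 + g i
  f-suc i = sym (m+[n∸m]≡n (mono z≤n))
  g-mono : ∀ {i j} → i F.≤ j → g i ≤ g j
  g-mono i≤j = ∸-monoˡ-≤ f0 (mono (s≤s i≤j))
  weighted-split : ∑ (λ i → w i * f (F.suc i)) ≡ f0 * sumBelow ω (suc n) + ∑ (λ i → w i * g i)
  weighted-split = ≡.begin
    ∑ (λ i → w i * f (F.suc i))
      ≡.≡⟨ ∑-cong (λ i → trans (cong (w i *_) (f-suc i)) (*-distribˡ-+ (w i) f0 (g i))) ⟩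
    ∑ (λ i → w i * f0 + w i * g i)
      ≡.≡⟨ ∑-distrib-+ (λ i → w i * f0) (λ i → w i * g i) ⟩
    ∑ (λ i → w i * f0) + ∑ (λ i → w i * g i)
      ≡.≡⟨ cong (_+ ∑ (λ i → w i * g i)) (trans (∑-distribʳ f0 w) (*-comm (∑ w) f0)) ⟩
    f0 * sumBelow ω (suc n) + ∑ (λ i → w i * g i) ≡.∎
    where module ≡ = ≡-Reasoning
  split : ∑ (f ∘ F.suc) ≡ suc n * f0 + ∑ g
  split = trans (∑-cong f-suc) (trans (∑-distrib-+ (λ _ → f0) g) (cong (_+ ∑ g) (∑-const (suc n) f0)))
  regroup : ∀ a f0 Ω X gl E → a * f0 + (f0 * Ω + X) + (f0 + gl) * E ≡ f0 * (E + (a + Ω)) + (X + gl * E)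
  regroup = solve-∀
  regroup′ : ∀ f0 n C G → f0 * (suc (suc n) * C) + C * G ≡ C * (f0 + (suc n * f0 + G))
  regroup′ = solve-∀

-- The layer inequality of the header for P = 1, where geom p k = 1 + p + ⋯ + p ^ (k - 1).
LayerBound : ℕ → ℕ → ℕ → Set
LayerBound q h k = 1 + p * geom p h + q * (1 + h * p) * geom p k ≤ k * (p * p * geom p h)
  where p = suc q

layerBound-1-2 : ∀ q → 1 ≤ q → LayerBound q 2 1
layerBound-1-2 (suc q₀) _ = m+d≡n⇒m≤n (p * p * q₀) (identity q₀)
  where
  p = 2 + q₀
  identity : ∀ q₀ → let p = 2 + q₀ in
    1 + p * (p * 1 + (1 + 0)) + (1 + q₀) * (1 + 2 * p) * (1 + 0) + p * p * q₀
      ≡ 1 * (p * p * (p * 1 + (1 + 0)))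
  identity = solve-∀

layerBound-diag : ∀ q j → LayerBound q (2 + j) (2 + j)
layerBound-diag q j = begin
  1 + p * G + K * G ≤⟨ +-monoˡ-≤ (K * G) (+-monoˡ-≤ (p * G) (geom-pos q k (s≤s z≤n))) ⟩
  G + p * G + K * G ≤⟨ m+d≡n⇒m≤n (j * p * G) (identity q j G) ⟩
  k * (p * p * G)   ∎
  where
  k = 2 + j
  p = suc q
  K = q * (1 + k * p)
  G = geom p k
  open ≤-Reasoning
  identity : ∀ q j G → let p = suc q; k = 2 + j in
    G + p * G + q * (1 + k * p) * G + j * p * G ≡ k * (p * p * G)
  identity = solve-∀

-- Raising h adds p ^ (h + 1) + p q (geom p k) ≤ 2 p ^ (h + 1) on the left, as q (geom p k) < p ^ k,
-- and k p² p ^ h on the right.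
layerBound-step : ∀ q {h k} → 1 ≤ q → 1 ≤ k → k ≤ h → LayerBound q h k → LayerBound q (suc h) k
layerBound-step q@(suc q₀) {h} {k@(suc k₀)} _ _ k≤h bound = begin
  1 + p * (p ^ h + Gh) + q * (1 + suc h * p) * Gk
    ≡⟨ shift p q h (p ^ h) Gh Gk ⟩
  (1 + p * Gh + q * (1 + h * p) * Gk) + (p * p ^ h + p * (q * Gk))
    ≤⟨ +-mono-≤ bound (+-monoʳ-≤ (p * p ^ h) (*-monoʳ-≤ p qGk≤p^h)) ⟩
  k * (p * p * Gh) + (p * p ^ h + p * p ^ h)
    ≤⟨ +-monoʳ-≤ (k * (p * p * Gh)) (m+d≡n⇒m≤n _ (double q₀ k₀ (p ^ h))) ⟩
  k * (p * p * Gh) + k * (p * p * p ^ h)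
    ≡⟨ merge k p Gh (p ^ h) ⟩
  k * (p * p * (p ^ h + Gh)) ∎
  where
  p = suc q
  Gh = geom p h
  Gk = geom p k
  open ≤-Reasoning
  qGk≤p^h : q * Gk ≤ p ^ h
  qGk≤p^h = ≤-trans (m+d≡n⇒m≤n 1 (geom-identity q k)) (^-monoʳ-≤ p k≤h)
  shift : ∀ p q h x Gh Gk → 1 + p * (x + Gh) + q * (1 + suc h * p) * Gk
        ≡ (1 + p * Gh + q * (1 + h * p) * Gk) + (p * x + p * (q * Gk))
  shift = solve-∀
  double : ∀ q₀ k₀ x → let p = 2 + q₀ in
    p * x + p * x + (k₀ * (p * p * x) + q₀ * (p * x)) ≡ (1 + k₀) * (p * p * x)
  double = solve-∀
  merge : ∀ k p G x → k * (p * p * G) + k * (p * p * x) ≡ k * (p * p * (x + G))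
  merge = solve-∀

layerBound-upward : ∀ q {h h′ k} → 1 ≤ q → 1 ≤ k → k ≤ h → h ≤′ h′ →
  LayerBound q h k → LayerBound q h′ k
layerBound-upward q 1≤q 1≤k k≤h ≤′-refl          bound = bound
layerBound-upward q 1≤q 1≤k k≤h (≤′-step h≤′h′) bound =
  layerBound-step q 1≤q 1≤k (≤-trans k≤h (≤′⇒≤ h≤′h′)) (layerBound-upward q 1≤q 1≤k k≤h h≤′h′ bound)

layerBound : ∀ q {h k} → 1 ≤ q → 2 ≤ h → 1 ≤ k → k ≤ h → LayerBound q h k
layerBound q {k = 1} 1≤q 2≤h 1≤k _ =
  layerBound-upward q 1≤q 1≤k (s≤s z≤n) (≤⇒≤′ 2≤h) (layerBound-1-2 q 1≤q)
layerBound q {k = suc (suc k)} 1≤q _ 1≤k k≤h =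
  layerBound-upward q 1≤q 1≤k ≤-refl (≤⇒≤′ k≤h) (layerBound-diag q k)

layerBound-scaled : ∀ q {h k} P → 1 ≤ P → LayerBound q h k →
  let p = suc q; W = P * geom p h in
  (p * W + 1) + q * (1 + h * p) * (P * geom p k) ≤ k * (p * p * W)
layerBound-scaled q {h} {k} P 1≤P bound = begin
  (p * (P * Gh) + 1) + K * (P * Gk) ≡⟨ regroup P p Gh K Gk ⟩
  1 + P * (p * Gh + K * Gk)         ≤⟨ +-monoˡ-≤ (P * (p * Gh + K * Gk)) 1≤P ⟩
  P + P * (p * Gh + K * Gk)         ≡⟨ regroup′ P p Gh K Gk ⟩
  P * (1 + p * Gh + K * Gk)         ≤⟨ *-monoʳ-≤ P bound ⟩
  P * (k * (p * p * Gh))            ≡⟨ regroup″ P p Gh k ⟩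
  k * (p * p * (P * Gh))            ∎
  where
  p = suc q
  K = q * (1 + h * p)
  Gh = geom p h
  Gk = geom p k
  open ≤-Reasoning
  regroup : ∀ P p Gh K Gk → (p * (P * Gh) + 1) + K * (P * Gk) ≡ 1 + P * (p * Gh + K * Gk)
  regroup = solve-∀
  regroup′ : ∀ P p Gh K Gk → P + P * (p * Gh + K * Gk) ≡ P * (1 + p * Gh + K * Gk)
  regroup′ = solve-∀
  regroup″ : ∀ P p Gh k → P * (k * (p * p * Gh)) ≡ k * (p * p * (P * Gh))
  regroup″ = solve-∀

toℚᵘ-ℕ→ℚ : ∀ a → toℚᵘ (ℕ→ℚ a) ≃ mkℚᵘ (+ a) 0
toℚᵘ-ℕ→ℚ a = ℚ.toℚᵘ-fromℚᵘ (mkℚᵘ (+ a) 0)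

toℚᵘ-÷ℕ : ∀ x d → toℚᵘ (x ÷ℕ suc d) ≃ toℚᵘ x ℚᵘ.* mkℚᵘ (+ 1) d
toℚᵘ-÷ℕ x d = ℚᵘ.≃-trans (ℚ.toℚᵘ-homo-* x _) (ℚᵘ.*-congˡ {toℚᵘ x} (ℚ.toℚᵘ-fromℚᵘ (mkℚᵘ (+ 1) d)))

toℚᵘ-ℕ÷ℕ : ∀ a d → toℚᵘ (ℕ→ℚ a ÷ℕ suc d) ≃ mkℚᵘ (+ a) d
toℚᵘ-ℕ÷ℕ a d = ℚᵘ.≃-trans (toℚᵘ-÷ℕ (ℕ→ℚ a) d) (ℚᵘ.≃-trans (ℚᵘ.*-congʳ (toℚᵘ-ℕ→ℚ a))
  (*≡* (cong₂ ℤ._*_ (ℤ.*-identityʳ (+ a)) (cong (λ n → + suc n) (sym (+-identityʳ d))))))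

ad<cb⇒a/b<c/d : ∀ {a b c d} → 1 ≤ b → 1 ≤ d → a * d <ℕ c * b → ℕ→ℚ a ÷ℕ b < ℕ→ℚ c ÷ℕ d
ad<cb⇒a/b<c/d {a} {suc b} {c} {suc d} _ _ ad<cb = ℚ.toℚᵘ-cancel-<
  (ℚᵘ.<-respˡ-≃ (ℚᵘ.≃-sym (toℚᵘ-ℕ÷ℕ a b)) (ℚᵘ.<-respʳ-≃ (ℚᵘ.≃-sym (toℚᵘ-ℕ÷ℕ c d))
    (*<* (subst₂ ℤ._<_ (ℤ.pos-* a (suc d)) (ℤ.pos-* c (suc b)) (ℤ.+<+ ad<cb)))))

toℚᵘ-[1-1/p+c] : ∀ q c → toℚᵘ ((ℕ→ℚ 1 - (ℕ→ℚ 1 ÷ℕ suc q)) +ℚ ℕ→ℚ c)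
  ≃ (mkℚᵘ (+ 1) 0 ℚᵘ.+ ℚᵘ.- mkℚᵘ (+ 1) q) ℚᵘ.+ mkℚᵘ (+ c) 0
toℚᵘ-[1-1/p+c] q c = begin
  toℚᵘ ((ℕ→ℚ 1 - 1/p) +ℚ ℕ→ℚ c)           ≈⟨ ℚ.toℚᵘ-homo-+ (ℕ→ℚ 1 - 1/p) (ℕ→ℚ c) ⟩
  toℚᵘ (ℕ→ℚ 1 - 1/p) ℚᵘ.+ toℚᵘ (ℕ→ℚ c)    ≈⟨ ℚᵘ.+-congˡ (toℚᵘ (ℕ→ℚ c)) (ℚ.toℚᵘ-homo-+ (ℕ→ℚ 1) (- 1/p)) ⟩
  (toℚᵘ (ℕ→ℚ 1) ℚᵘ.+ toℚᵘ (- 1/p)) ℚᵘ.+ toℚᵘ (ℕ→ℚ c)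
    ≈⟨ ℚᵘ.+-cong (ℚᵘ.+-cong (toℚᵘ-ℕ→ℚ 1) (ℚᵘ.≃-trans (ℚ.toℚᵘ-homo‿- 1/p) (ℚᵘ.-‿cong (toℚᵘ-ℕ÷ℕ 1 q))))
                 (toℚᵘ-ℕ→ℚ c) ⟩
  (mkℚᵘ (+ 1) 0 ℚᵘ.+ ℚᵘ.- mkℚᵘ (+ 1) q) ℚᵘ.+ mkℚᵘ (+ c) 0 ∎
  where
  1/p = ℕ→ℚ 1 ÷ℕ suc q
  open ℚᵘ.≃-Reasoning

[1-1/p+c]/D≡[q+cp]/pD : ∀ q c {D} → 1 ≤ D →
  ((ℕ→ℚ 1 - (ℕ→ℚ 1 ÷ℕ suc q)) +ℚ ℕ→ℚ c) ÷ℕ D ≡ ℕ→ℚ (q + c * suc q) ÷ℕ (suc q * D)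
[1-1/p+c]/D≡[q+cp]/pD q c {suc d} _ = ℚ.toℚᵘ-injective (begin
  toℚᵘ (x ÷ℕ suc d)
    ≈⟨ ℚᵘ.≃-trans (toℚᵘ-÷ℕ x d) (ℚᵘ.*-congʳ (toℚᵘ-[1-1/p+c] q c)) ⟩
  ((mkℚᵘ (+ 1) 0 ℚᵘ.+ ℚᵘ.- mkℚᵘ (+ 1) q) ℚᵘ.+ mkℚᵘ (+ c) 0) ℚᵘ.* mkℚᵘ (+ 1) d
    ≈⟨ *≡* (cross-multiplied (+ q) (+ c) (+ d)) ⟩
  mkℚᵘ (+ q ℤ.+ + c ℤ.* + suc q) (d + q * suc d)
    ≈⟨ ℚᵘ.≃-reflexive (cong (λ n → mkℚᵘ n (d + q * suc d)) numerator) ⟩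
  mkℚᵘ (+ (q + c * suc q)) (d + q * suc d)
    ≈⟨ toℚᵘ-ℕ÷ℕ (q + c * suc q) (d + q * suc d) ⟨
  toℚᵘ (ℕ→ℚ (q + c * suc q) ÷ℕ (suc q * suc d)) ∎)
  where
  x = (ℕ→ℚ 1 - (ℕ→ℚ 1 ÷ℕ suc q)) +ℚ ℕ→ℚ c
  open ℚᵘ.≃-Reasoning
  -- ↥ _ * ↧ _ ≡ ↥ _ * ↧ _ exactly as it unfolds from the ℚᵘ operations, with x for + q.
  cross-multiplied : ∀ x c d → let p = + 1 ℤ.+ x in
    ((((+ 1) ℤ.* p ℤ.+ (ℤ.- + 1) ℤ.* (+ 1)) ℤ.* (+ 1) ℤ.+ c ℤ.* ((+ 1) ℤ.* p)) ℤ.* (+ 1))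
        ℤ.* (p ℤ.* (+ 1 ℤ.+ d))
      ≡ (x ℤ.+ c ℤ.* p) ℤ.* ((((+ 1) ℤ.* p) ℤ.* (+ 1)) ℤ.* (+ 1 ℤ.+ d))
  cross-multiplied = ℤ.solve-∀
  numerator : + q ℤ.+ + c ℤ.* + suc q ≡ + (q + c * suc q)
  numerator = trans (cong (λ n → + q ℤ.+ n) (sym (ℤ.pos-* c (suc q)))) (sym (ℤ.pos-+ q (c * suc q)))

module _ (q n r : ℕ) (1≤q : 1 ≤ q) (1≤n : 1 ≤ n) (h≤r : suc n ≤ r) (ℓ : Fin (suc n) → ℕ)
         (ℓ≤q : ∀ i → ℓ i ≤ q) (ℓ-antitone : ∀ i j → i F.≤ j → ℓ j ≤ ℓ i) where

  private
    p h P W : ℕ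
    p = suc q
    h = suc n
    P = p ^ (r ∸ h)
    W = P * geom p h

    weight : Fin h → ℕ
    weight i = p ^ (r ∸ suc (toℕ i))

    T S A den : ℕ
    T = ∑ (λ i → weight i * (ℓ i + 1))
    S = ∑ ℓ
    A = ∑ (λ i → weight i * ℓ i)
    den = p ^ (r + 1 ∸ h) * (p ^ h ∸ 1)

    weight≡ : ∀ i → weight i ≡ P * p ^ (n ∸ toℕ i)
    weight≡ i = begin
      p ^ (r ∸ suc (toℕ i))           ≡⟨ cong (λ e → p ^ (e ∸ suc (toℕ i))) (m∸n+n≡m h≤r) ⟨
      p ^ ((r ∸ h) + h ∸ suc (toℕ i)) ≡⟨ cong (p ^_) (+-∸-assoc (r ∸ h) (toℕ<n i)) ⟩
      p ^ ((r ∸ h) + (n ∸ toℕ i))     ≡⟨ ^-distribˡ-+-* p (r ∸ h) (n ∸ toℕ i) ⟩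
      P * p ^ (n ∸ toℕ i)             ∎
      where open ≡-Reasoning

    ∑weight≡W : ∑ weight ≡ W
    ∑weight≡W = trans (∑-cong {h} weight≡) (∑-distribˡ {h} P (λ i → p ^ (n ∸ toℕ i)))

    ∑weight*q≡qW : ∑ (λ i → weight i * q) ≡ q * W
    ∑weight*q≡qW = trans (∑-distribʳ q weight) (trans (cong (_* q) ∑weight≡W) (*-comm W q))

    T≡A+W : T ≡ A + W
    T≡A+W = begin
      ∑ (λ i → weight i * (ℓ i + 1))
        ≡⟨ ∑-cong (λ i → *-distribˡ-+ (weight i) (ℓ i) 1) ⟩
      ∑ (λ i → weight i * ℓ i + weight i * 1)
        ≡⟨ ∑-distrib-+ (λ i → weight i * ℓ i) (λ i → weight i * 1) ⟩
      A + ∑ (λ i → weight i * 1)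
        ≡⟨ cong (λ s → A + s) (trans (∑-cong (λ i → *-identityʳ (weight i))) ∑weight≡W) ⟩
      A + W ∎
      where open ≡-Reasoning

    den≡ : den ≡ p * (q * W)
    den≡ = begin
      p ^ (r + 1 ∸ h) * (p ^ h ∸ 1)
        ≡⟨ cong₂ _*_ (cong (p ^_) (trans (+-∸-comm 1 h≤r) (+-comm (r ∸ h) 1)))
                     (cong (_∸ 1) (sym (geom-identity q h))) ⟩
      p * P * (q * geom p h + 1 ∸ 1)
        ≡⟨ cong (p * P *_) (m+n∸n≡m (q * geom p h) 1) ⟩
      p * P * (q * geom p h)
        ≡⟨ regroup p P q (geom p h) ⟩
      p * (q * W) ∎
      where
      open ≡-Reasoning
      regroup : ∀ p P q G → p * P * (q * G) ≡ p * (q * (P * G))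
      regroup = solve-∀

  equality-case : (∀ i → ℓ i ≡ q) → ℕ→ℚ (1 + S) ÷ℕ (q * T) ≡ ℕ→ℚ (1 + h * q) ÷ℕ den
  equality-case ℓ≡q = cong₂ (λ a b → ℕ→ℚ (1 + a) ÷ℕ b) (trans (∑-cong ℓ≡q) (∑-const h q)) qT≡den
    where
    qT≡den : q * T ≡ den
    qT≡den = begin
      q * T           ≡⟨ cong (q *_) T≡A+W ⟩
      q * (A + W)     ≡⟨ cong (λ a → q * (a + W)) (trans (∑-cong (λ i → cong (weight i *_) (ℓ≡q i))) ∑weight*q≡qW) ⟩
      q * (q * W + W) ≡⟨ regroup q W ⟩
      p * (q * W)     ≡⟨ den≡ ⟨
      den             ∎
      where
      open ≡-Reasoning
      regroup : ∀ q W → q * (q * W + W) ≡ suc q * (q * W)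
      regroup = solve-∀

  strict-case : ¬ (∀ i → ℓ i ≡ q) →
    ℕ→ℚ (1 + S) ÷ℕ (q * T) < ((ℕ→ℚ 1 - (ℕ→ℚ 1 ÷ℕ p)) +ℚ ℕ→ℚ (h * q)) ÷ℕ den
  strict-case ℓ≢q = subst (ℕ→ℚ (1 + S) ÷ℕ (q * T) <_) (sym ([1-1/p+c]/D≡[q+cp]/pD q (h * q) den-pos))
    (ad<cb⇒a/b<c/d {1 + S} {q * T} {q + h * q * p} {p * den}
      qT-pos (*-mono-≤ {1} {p} (s≤s z≤n) den-pos) cross-multiplied)
    where
    deficit : Fin h → ℕ
    deficit i = q ∸ ℓ i

    M B K E C : ℕ
    M = ∑ deficit
    B = ∑ (λ i → weight i * deficit i)
    K = q * (1 + h * p)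
    E = p * W + 1
    C = p * p * W

    W-pos : 1 ≤ W
    W-pos = *-mono-≤ (m^n>0 p (r ∸ h)) (geom-pos q h (s≤s z≤n))

    den-pos : 1 ≤ den
    den-pos = subst (1 ≤_) (sym den≡) (*-mono-≤ {1} {p} (s≤s z≤n) (*-mono-≤ 1≤q W-pos))

    qT-pos : 1 ≤ q * T
    qT-pos = *-mono-≤ 1≤q (subst (1 ≤_) (sym T≡A+W) (≤-trans W-pos (m≤n+m W A)))

    S+M≡hq : S + M ≡ h * q
    S+M≡hq = trans (sym (∑-distrib-+ ℓ deficit)) (trans (∑-cong (λ i → m+[n∸m]≡n (ℓ≤q i))) (∑-const h q))

    A+B≡qW : A + B ≡ q * W
    A+B≡qW = begin
      A + B                                           ≡⟨ ∑-distrib-+ (λ i → weight i * ℓ i) (λ i → weight i * deficit i) ⟨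
      ∑ (λ i → weight i * ℓ i + weight i * deficit i) ≡⟨ ∑-cong (λ i → *-distribˡ-+ (weight i) (ℓ i) (deficit i)) ⟨
      ∑ (λ i → weight i * (ℓ i + deficit i))          ≡⟨ ∑-cong (λ i → cong (weight i *_) (m+[n∸m]≡n (ℓ≤q i))) ⟩
      ∑ (λ i → weight i * q)                          ≡⟨ ∑weight*q≡qW ⟩
      q * W                                           ∎
      where open ≡-Reasoning

    deficit-mono : ∀ {i j} → i F.≤ j → deficit i ≤ deficit j
    deficit-mono {i} {j} i≤j = ∸-monoʳ-≤ q (ℓ-antitone i j i≤j)

    last-deficit-pos : 1 ≤ deficit (fromℕ n)
    last-deficit-pos with ℓ (fromℕ n) ≟ q
    ... | yes ℓlast≡q = contradiction ℓ≡q ℓ≢q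
      where
      ℓ≡q : ∀ i → ℓ i ≡ q
      ℓ≡q i = ≤-antisym (ℓ≤q i) (subst (_≤ ℓ i) ℓlast≡q (ℓ-antitone i (fromℕ n) (≤fromℕ i)))
    ... | no  ℓlast≢q = m<n⇒0<n∸m (≤∧≢⇒< (ℓ≤q (fromℕ n)) ℓlast≢q)

    layer-weight : ℕ → ℕ
    layer-weight d = K * (P * p ^ d)

    layers : ∀ k → k ≤ n → E + sumBelow layer-weight (suc k) ≤ suc k * C
    layers k k≤n = subst (λ s → E + s ≤ suc k * C)
      (sym (trans (∑-distribˡ {suc k} K (λ i → P * p ^ (k ∸ toℕ i)))
                  (cong (K *_) (∑-distribˡ {suc k} P (λ i → p ^ (k ∸ toℕ i))))))
      (layerBound-scaled q {h} {suc k} P (m^n>0 p (r ∸ h))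
        (layerBound q 1≤q (s≤s 1≤n) (s≤s z≤n) (s≤s k≤n)))

    KB+E≤CM : K * B + E ≤ C * M
    KB+E≤CM = begin
      K * B + E
        ≤⟨ +-monoʳ-≤ (K * B) (m≤n*m E (deficit (fromℕ n)) {{>-nonZero last-deficit-pos}}) ⟩
      K * B + deficit (fromℕ n) * E
        ≡⟨ cong (_+ deficit (fromℕ n) * E) weighted ⟨
      ∑ (λ i → layer-weight (n ∸ toℕ i) * deficit i) + deficit (fromℕ n) * E
        ≤⟨ abel-bound layer-weight C E n layers deficit deficit-mono ⟩
      C * M ∎
      where
      open ≤-Reasoning
      weighted : ∑ (λ i → layer-weight (n ∸ toℕ i) * deficit i) ≡ K * B
      weighted = trans
        (∑-cong (λ i → trans (*-assoc K (P * p ^ (n ∸ toℕ i)) (deficit i))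
                             (cong (λ w → K * (w * deficit i)) (sym (weight≡ i)))))
        (∑-distribˡ K (λ i → weight i * deficit i))

    core : (1 + S) * C <ℕ K * (A + W)
    core = +-cancelʳ-≤ (C * M) _ _ (begin
      suc ((1 + S) * C) + C * M ≡⟨ regroup₁ S M C ⟩
      C * (1 + (S + M)) + 1     ≡⟨ cong (λ s → C * (1 + s) + 1) S+M≡hq ⟩
      C * (1 + h * q) + 1       ≡⟨ regroup₂ q h W ⟩
      K * (q * W + W) + E       ≡⟨ cong (λ a → K * (a + W) + E) A+B≡qW ⟨
      K * ((A + B) + W) + E     ≡⟨ regroup₃ K A B W E ⟩
      K * (A + W) + (K * B + E) ≤⟨ +-monoʳ-≤ (K * (A + W)) KB+E≤CM ⟩
      K * (A + W) + C * M       ∎)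
      where
      open ≤-Reasoning
      regroup₁ : ∀ S M C → suc ((1 + S) * C) + C * M ≡ C * (1 + (S + M)) + 1
      regroup₁ = solve-∀
      regroup₂ : ∀ q h W → let p = suc q in
        p * p * W * (1 + h * q) + 1 ≡ q * (1 + h * p) * (q * W + W) + (p * W + 1)
      regroup₂ = solve-∀
      regroup₃ : ∀ K A B W E → K * ((A + B) + W) + E ≡ K * (A + W) + (K * B + E)
      regroup₃ = solve-∀

    cross-multiplied : (1 + S) * (p * den) <ℕ (q + h * q * p) * (q * T)
    cross-multiplied = begin-strict
      (1 + S) * (p * den)             ≡⟨ cong (λ d → (1 + S) * (p * d)) den≡ ⟩
      (1 + S) * (p * (p * (q * W)))   ≡⟨ regroup q S W ⟩
      q * ((1 + S) * C)               <⟨ *-monoʳ-< q {{>-nonZero 1≤q}} core ⟩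
      q * (K * (A + W))               ≡⟨ regroup′ q h (A + W) ⟩
      (q + h * q * p) * (q * (A + W)) ≡⟨ cong (λ t → (q + h * q * p) * (q * t)) T≡A+W ⟨
      (q + h * q * p) * (q * T)       ∎
      where
      open ≤-Reasoning
      regroup : ∀ q S W → let p = suc q in (1 + S) * (p * (p * (q * W))) ≡ q * ((1 + S) * (p * p * W))
      regroup = solve-∀
      regroup′ : ∀ q h X → let p = suc q in q * (q * (1 + h * p) * X) ≡ (q + h * q * p) * (q * X)
      regroup′ = solve-∀

lemma5p29 : (p h r : ℕ) → Prime p → 2 ≤ h → h ≤ r →
    (ℓ : Fin h → ℕ) →
    (∀ i → ℓ i ≤ p ∸ 1) →
    (∀ i j → i F.≤ j → ℓ j ≤ ℓ i) →
    (∀ i → 1 ≤ ℓ i) →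
    let lhs = ℕ→ℚ (1 + sum (tabulate ℓ))
              ÷ℕ ((p ∸ 1) * sum (tabulate (λ i → p ^ (r ∸ suc (toℕ i)) * (ℓ i + 1))))
        den = p ^ (r + 1 ∸ h) * (p ^ h ∸ 1)
    in ((¬ (∀ i → ℓ i ≡ p ∸ 1)) →
          lhs < ((ℕ→ℚ 1 - (ℕ→ℚ 1 ÷ℕ p)) +ℚ ℕ→ℚ (h * (p ∸ 1))) ÷ℕ den)
     × ((∀ i → ℓ i ≡ p ∸ 1) →
          lhs ≡ ℕ→ℚ (1 + h * (p ∸ 1)) ÷ℕ den)
lemma5p29 p h r p-prime 2≤h h≤r ℓ ℓ≤p-1 ℓ-antitone _ with nonTrivial⇒n>1 p {{prime⇒nonTrivial p-prime}}
lemma5p29 (suc q) (suc n) r _ (s≤s 1≤n) h≤r ℓ ℓ≤q ℓ-antitone _ | s≤s 1≤q =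
  strict-case q n r 1≤q 1≤n h≤r ℓ ℓ≤q ℓ-antitone , equality-case q n r 1≤q 1≤n h≤r ℓ ℓ≤q ℓ-antitone
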